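{- Let $G$ be a finite simple undirected graph and $\delta\in(0,\infty)$. A vector $x\in\mathbb{Z}^{V(G)}$ is a solution of $\mathrm{LCP}_\delta(G)$ if and only if $x$ is the characteristic vector of a $\lceil 1/\delta\rceil$-dominating independent set of $G$.
   Context: For a graph $G$ with adjacency matrix $A$ and $\delta>0$, $\mathrm{LCP}_\delta(G)$ is the problem: find $x\in\mathbb{R}^{V(G)}$ with $x\ge 0$, $(I+\delta A)x-\mathbf{e}\ge 0$ and $x^\top((I+\delta A)x-\mathbf{e})=0$, where $\mathbf{e}$ is the all-ones vector. A set $D\subset V(G)$ is $k$-dominating if every vertex not in $D$ has at least $k$ neighbours in $D$; a $k$-dominating independent set is a set that is both $k$-dominating and independent (no two of its vertices adjacent). -}

module Defs where

open import Level using (0ℓ)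
open import Data.Nat as ℕ using (ℕ; zero; suc)
open import Data.Integer as ℤ using (ℤ; +_; -[1+_])
open import Data.Fin using (Fin; zero; suc)
open import Data.Bool using (Bool; true; false; if_then_else_; _∧_)
open import Data.Product using (_×_; Σ; _,_)
open import Relation.Binary.PropositionalEquality using (_≡_; _≢_)
open import Relation.Nullary using (¬_)
open import Algebra.Structures using (IsCommutativeRing)
open import Relation.Binary.Structures using (IsTotalOrder)

-- We therefore work
-- over an arbitrary ordered field equipped with a ceiling function
-- (i.e. an Archimedean ordered field such as ℝ).  The theorem is stated
-- for every such structure, so in particular for ℝ.

embℕ : {A : Set} → (A → A → A) → A → A → ℕ → A
embℕ _+_ 0# 1# zero    = 0#
embℕ _+_ 0# 1# (suc n) = 1# + embℕ _+_ 0# 1# n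

embℤ : {A : Set} → (A → A → A) → (A → A) → A → A → ℤ → A
embℤ _+_ -_ 0# 1# (+ n)    = embℕ _+_ 0# 1# n
embℤ _+_ -_ 0# 1# -[1+ n ] = - embℕ _+_ 0# 1# (suc n)

strict : {A : Set} → (A → A → Set) → A → A → Set
strict _≤_ x y = (x ≤ y) × ¬ (x ≡ y)

record OrderedField : Set₁ where
  infixl 6 _+_
  infixl 7 _*_
  infix  4 _≤_
  field
    Carrier : Set
    _+_ _*_ : Carrier → Carrier → Carrier
    -_      : Carrier → Carrier
    0# 1#   : Carrier
    _≤_     : Carrier → Carrier → Set
    isCommutativeRing : IsCommutativeRing _≡_ _+_ _*_ -_ 0# 1#
    isTotalOrder      : IsTotalOrder _≡_ _≤_
    0≢1     : 0# ≢ 1#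
    +-mono-≤ : ∀ {x y} z → x ≤ y → x + z ≤ y + z
    *-nonneg : ∀ {x y} → 0# ≤ x → 0# ≤ y → 0# ≤ x * y
    -- multiplicative inverse (value at 0 irrelevant)
    inv     : Carrier → Carrier
    inv-law : ∀ x → x ≢ 0# → x * inv x ≡ 1#

  field
    ceil      : Carrier → ℤ
    ceil-spec : ∀ r → strict _≤_ (embℤ _+_ -_ 0# 1# (ceil r ℤ.- ℤ.1ℤ)) r
                      × (r ≤ embℤ _+_ -_ 0# 1# (ceil r))

  _-_ : Carrier → Carrier → Carrier
  x - y = x + (- y)

  _<_ : Carrier → Carrier → Set
  _<_ = strict _≤_

  fromℤ : ℤ → Carrier
  fromℤ = embℤ _+_ -_ 0# 1#

record SimpleGraph (n : ℕ) : Set where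
  field
    adj    : Fin n → Fin n → Bool
    sym    : ∀ u v → adj u v ≡ adj v u
    irrefl : ∀ v → adj v v ≡ false

open SimpleGraph public

count : {n : ℕ} → (Fin n → Bool) → ℕ
count {zero}  f = 0
count {suc n} f = (if f zero then 1 else 0) ℕ.+ count (λ i → f (suc i))

VSet : ℕ → Set
VSet n = Fin n → Bool

nbrsIn : {n : ℕ} → SimpleGraph n → VSet n → Fin n → ℕ
nbrsIn G D v = count (λ u → adj G v u ∧ D u)

Independent : {n : ℕ} → SimpleGraph n → VSet n → Set
Independent G D = ∀ u v → D u ≡ true → D v ≡ true → adj G u v ≡ false

KDominating : {n : ℕ} → ℤ → SimpleGraph n → VSet n → Set
KDominating k G D = ∀ v → D v ≡ false → k ℤ.≤ + nbrsIn G D v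

IsCharVec : {n : ℕ} → (Fin n → ℤ) → VSet n → Set
IsCharVec x D = ∀ v → x v ≡ (if D v then ℤ.1ℤ else ℤ.0ℤ)

module _ (F : OrderedField) where
  open OrderedField F

  sumF : {n : ℕ} → (Fin n → Carrier) → Carrier
  sumF {zero}  f = 0#
  sumF {suc n} f = f zero + sumF (λ i → f (suc i))

  adjMat : {n : ℕ} → SimpleGraph n → Fin n → Fin n → Carrier
  adjMat G v u = if adj G v u then 1# else 0#

  lcpSlack : {n : ℕ} → SimpleGraph n → Carrier → (Fin n → Carrier) → Fin n → Carrier
  lcpSlack G δ x v = (x v + δ * sumF (λ u → adjMat G v u * x u)) - 1#

  IsLCPSolution : {n : ℕ} → SimpleGraph n → Carrier → (Fin n → Carrier) → Set
  IsLCPSolution G δ x =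
    (∀ v → 0# ≤ x v)
    × (∀ v → 0# ≤ lcpSlack G δ x v)
    × (sumF (λ v → x v * lcpSlack G δ x v) ≡ 0#)

module Submission where

-- Complementarity is a vanishing sum of nonnegative terms, so x_v w_v = 0 at every
-- vertex, where w = (I + δA)x - e.  An integral solution is therefore 0/1-valued:
-- x_v ≥ 2 would give w_v ≥ x_v - 1 > 0.  For its support D one has
-- w_v = δ |N(v) ∩ D| on D, which vanishes iff D has no edge at v, and
-- w_v = δ |N(v) ∩ D| - 1 off D, which is nonnegative iff |N(v) ∩ D| ≥ 1/δ,
-- i.e. iff |N(v) ∩ D| ≥ ⌈1/δ⌉.

open import Defs hiding (sym)
open import Data.Nat using (ℕ)
open import Data.Integer using (ℤ)
open import Data.Fin using (Fin)
open import Data.Product using (Σ; _×_)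
open import Function.Bundles using (_⇔_)

import Data.Nat as ℕ
import Data.Nat.Properties as ℕ
import Data.Integer as ℤ
open import Data.Integer using (+_; -[1+_])
open import Data.Fin using (zero; suc)
open import Data.Bool using (Bool; true; false; if_then_else_; _∧_)
open import Data.Bool.Properties using (∧-identityʳ; ∧-zeroʳ)
open import Data.Product using (_,_; proj₁; proj₂)
open import Data.Sum using (_⊎_; inj₁; inj₂)
open import Data.Empty using (⊥-elim)
open import Function.Bundles using (mk⇔; Equivalence)
import Function.Properties.Equivalence as ⇔
open import Relation.Nullary using (¬_; yes; no)
open import Relation.Binary.PropositionalEquality
open import Relation.Binary.Structures using (IsTotalOrder)
open import Algebra.Bundles using (CommutativeRing)
open import Level using (0ℓ)

module OrderedFieldProperties (F : OrderedField) where
  open OrderedField F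
  open IsTotalOrder isTotalOrder using (total; antisym) renaming (refl to ≤-refl; trans to ≤-trans)

  commutativeRing : CommutativeRing 0ℓ 0ℓ
  commutativeRing = record { isCommutativeRing = isCommutativeRing }

  open CommutativeRing commutativeRing
    using (+-comm; +-identityˡ; +-identityʳ; -‿inverseʳ; *-assoc; *-comm;
           *-identityˡ; *-identityʳ; zeroˡ; zeroʳ; distribˡ; ring; +-group)
  open import Algebra.Properties.Ring ring using (-‿distribˡ-*; -‿distribʳ-*; -‿involutive)
  open import Algebra.Properties.Group +-group using (inverseˡ-unique; //-rightDividesˡ; //-rightDividesʳ)

  1+x-1≡x : ∀ x → (1# + x) - 1# ≡ x
  1+x-1≡x x = trans (cong (_- 1#) (+-comm 1# x)) (//-rightDividesʳ 1# x)

  -x*-x≡x*x : ∀ x → (- x) * (- x) ≡ x * x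
  -x*-x≡x*x x = begin
    (- x) * (- x) ≡⟨ sym (-‿distribˡ-* x (- x)) ⟩
    - (x * - x)   ≡⟨ cong -_ (sym (-‿distribʳ-* x x)) ⟩
    - - (x * x)   ≡⟨ -‿involutive (x * x) ⟩
    x * x         ∎
    where open ≡-Reasoning

  +-monoʳ-≤ : ∀ z {x y} → x ≤ y → z + x ≤ z + y
  +-monoʳ-≤ z {x} {y} p = subst₂ _≤_ (+-comm x z) (+-comm y z) (+-mono-≤ z p)

  x≤y⇒0≤y-x : ∀ {x y} → x ≤ y → 0# ≤ y - x
  x≤y⇒0≤y-x {x} p = subst (_≤ _) (-‿inverseʳ x) (+-mono-≤ (- x) p)

  0≤y-x⇒x≤y : ∀ {x y} → 0# ≤ y - x → x ≤ y
  0≤y-x⇒x≤y {x} {y} p = subst₂ _≤_ (+-identityˡ x) (//-rightDividesˡ x y) (+-mono-≤ x p)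

  x≤0⇒0≤-x : ∀ {x} → x ≤ 0# → 0# ≤ - x
  x≤0⇒0≤-x {x} p = subst (0# ≤_) (+-identityˡ (- x)) (x≤y⇒0≤y-x p)

  0≤x⇒-x≤0 : ∀ {x} → 0# ≤ x → - x ≤ 0#
  0≤x⇒-x≤0 {x} p = subst₂ _≤_ (+-identityˡ (- x)) (-‿inverseʳ x) (+-mono-≤ (- x) p)

  +-nonneg : ∀ {x y} → 0# ≤ x → 0# ≤ y → 0# ≤ x + y
  +-nonneg {x} {y} p q = ≤-trans p (subst (_≤ x + y) (+-identityʳ x) (+-monoʳ-≤ x q))

  x+y≡0⇒x≡0 : ∀ {x y} → 0# ≤ x → 0# ≤ y → x + y ≡ 0# → x ≡ 0#
  x+y≡0⇒x≡0 {x} {y} p q x+y≡0 =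
    antisym (subst (_≤ 0#) (sym (inverseˡ-unique x y x+y≡0)) (0≤x⇒-x≤0 q)) p

  0≤x*x : ∀ x → 0# ≤ x * x
  0≤x*x x with total 0# x
  ... | inj₁ 0≤x = *-nonneg 0≤x 0≤x
  ... | inj₂ x≤0 = subst (0# ≤_) (-x*-x≡x*x x) (*-nonneg (x≤0⇒0≤-x x≤0) (x≤0⇒0≤-x x≤0))

  0≤1 : 0# ≤ 1#
  0≤1 = subst (0# ≤_) (*-identityˡ 1#) (0≤x*x 1#)

  1≢0 : 1# ≢ 0#
  1≢0 1≡0 = 0≢1 (sym 1≡0)

  x*y≡0⇒y≡0 : ∀ {x y} → x * y ≡ 0# → x ≢ 0# → y ≡ 0#
  x*y≡0⇒y≡0 {x} {y} xy≡0 x≢0 = begin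
    y                 ≡⟨ sym (*-identityˡ y) ⟩
    1# * y            ≡⟨ cong (_* y) (sym (trans (*-comm (inv x) x) (inv-law x x≢0))) ⟩
    (inv x * x) * y   ≡⟨ *-assoc (inv x) x y ⟩
    inv x * (x * y)   ≡⟨ cong (inv x *_) xy≡0 ⟩
    inv x * 0#        ≡⟨ zeroʳ (inv x) ⟩
    0#                ∎
    where open ≡-Reasoning

  0<x⇒0≤inv : ∀ {x} → 0# < x → 0# ≤ inv x
  0<x⇒0≤inv {x} (0≤x , 0≢x) with total 0# (inv x)
  ... | inj₁ 0≤inv = 0≤inv
  ... | inj₂ inv≤0 = ⊥-elim (1≢0 (antisym 1≤0 0≤1))
    where
    0≤-1 : 0# ≤ - 1#
    0≤-1 = subst (0# ≤_)
      (trans (sym (-‿distribʳ-* x (inv x))) (cong -_ (inv-law x (λ x≡0 → 0≢x (sym x≡0)))))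
      (*-nonneg 0≤x (x≤0⇒0≤-x inv≤0))
    1≤0 : 1# ≤ 0#
    1≤0 = 0≤y-x⇒x≤y (subst (0# ≤_) (sym (+-identityˡ (- 1#))) 0≤-1)

  0≤xa-1⇔inv≤a : ∀ {x} → 0# < x → ∀ a → (0# ≤ (x * a) - 1#) ⇔ (inv x ≤ a)
  0≤xa-1⇔inv≤a {x} 0<x@(0≤x , 0≢x) a = mk⇔
    (λ 0≤xa-1 → 0≤y-x⇒x≤y (subst (0# ≤_) inv[xa-1]≡a-inv (*-nonneg (0<x⇒0≤inv 0<x) 0≤xa-1)))
    (λ inv≤a → subst (0# ≤_) x[a-inv]≡xa-1 (*-nonneg 0≤x (x≤y⇒0≤y-x inv≤a)))
    where
    x*inv≡1 : x * inv x ≡ 1#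
    x*inv≡1 = inv-law x (λ x≡0 → 0≢x (sym x≡0))
    inv[xa-1]≡a-inv : inv x * ((x * a) - 1#) ≡ a - inv x
    inv[xa-1]≡a-inv = trans (distribˡ (inv x) (x * a) (- 1#)) (cong₂ _+_
      (trans (sym (*-assoc (inv x) x a))
        (trans (cong (_* a) (trans (*-comm (inv x) x) x*inv≡1)) (*-identityˡ a)))
      (trans (sym (-‿distribʳ-* (inv x) 1#)) (cong -_ (*-identityʳ (inv x)))))
    x[a-inv]≡xa-1 : x * (a - inv x) ≡ (x * a) - 1#
    x[a-inv]≡xa-1 = trans (distribˡ x a (- inv x))
      (cong (_+_ (x * a)) (trans (sym (-‿distribʳ-* x (inv x))) (cong -_ x*inv≡1)))

  fromℕ : ℕ → Carrier
  fromℕ = embℕ _+_ 0# 1#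

  0≤fromℕ : ∀ m → 0# ≤ fromℕ m
  0≤fromℕ ℕ.zero    = ≤-refl
  0≤fromℕ (ℕ.suc m) = +-nonneg 0≤1 (0≤fromℕ m)

  fromℕ-mono-≤ : ∀ {m n} → m ℕ.≤ n → fromℕ m ≤ fromℕ n
  fromℕ-mono-≤ {n = n} ℕ.z≤n = 0≤fromℕ n
  fromℕ-mono-≤ (ℕ.s≤s m≤n)  = +-monoʳ-≤ 1# (fromℕ-mono-≤ m≤n)

  fromℕ-suc≢0 : ∀ m → fromℕ (ℕ.suc m) ≢ 0#
  fromℕ-suc≢0 m 1+m≡0 = 1≢0 (antisym (subst (1# ≤_) 1+m≡0 1≤1+m) 0≤1)
    where
    1≤1+m : 1# ≤ fromℕ (ℕ.suc m)
    1≤1+m = subst (_≤ fromℕ (ℕ.suc m)) (+-identityʳ 1#) (+-monoʳ-≤ 1# (0≤fromℕ m))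

  fromℕ≡0⇒≡0 : ∀ {m} → fromℕ m ≡ 0# → m ≡ 0
  fromℕ≡0⇒≡0 {ℕ.zero}  _     = refl
  fromℕ≡0⇒≡0 {ℕ.suc m} 1+m≡0 = ⊥-elim (fromℕ-suc≢0 m 1+m≡0)

  0≰-fromℕ-suc : ∀ m → ¬ (0# ≤ - fromℕ (ℕ.suc m))
  0≰-fromℕ-suc m 0≤-1-m = fromℕ-suc≢0 m (antisym 1+m≤0 (0≤fromℕ (ℕ.suc m)))
    where
    1+m≤0 : fromℕ (ℕ.suc m) ≤ 0#
    1+m≤0 = 0≤y-x⇒x≤y (subst (0# ≤_) (sym (+-identityˡ _)) 0≤-1-m)

  ceil≤+⇔≤fromℕ : ∀ r m → (ceil r ℤ.≤ + m) ⇔ (r ≤ fromℕ m)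
  ceil≤+⇔≤fromℕ r m = mk⇔ (to (ceil r) (ceil-spec r)) (from (ceil r) (ceil-spec r))
    where
    to : ∀ k → fromℤ (k ℤ.- ℤ.1ℤ) < r × r ≤ fromℤ k → k ℤ.≤ + m → r ≤ fromℕ m
    to -[1+ j ] (_ , r≤k) _ = ≤-trans r≤k (≤-trans (0≤x⇒-x≤0 (0≤fromℕ (ℕ.suc j))) (0≤fromℕ m))
    to (+ j)    (_ , r≤k) (ℤ.+≤+ j≤m) = ≤-trans r≤k (fromℕ-mono-≤ j≤m)
    from : ∀ k → fromℤ (k ℤ.- ℤ.1ℤ) < r × r ≤ fromℤ k → r ≤ fromℕ m → k ℤ.≤ + m
    from -[1+ j ]     _ _ = ℤ.-≤+
    from (+ ℕ.zero)   _ _ = ℤ.+≤+ ℕ.z≤n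
    from (+ ℕ.suc j) ((j≤r , j≢r) , _) r≤m with ℕ.suc j ℕ.≤? m
    ... | yes 1+j≤m = ℤ.+≤+ 1+j≤m
    ... | no  1+j≰m =
      ⊥-elim (j≢r (antisym j≤r (≤-trans r≤m (fromℕ-mono-≤ (ℕ.≤-pred (ℕ.≰⇒> 1+j≰m))))))

  sumF-nonneg : ∀ {n} (f : Fin n → Carrier) → (∀ i → 0# ≤ f i) → 0# ≤ sumF F f
  sumF-nonneg {ℕ.zero}  f 0≤f = ≤-refl
  sumF-nonneg {ℕ.suc n} f 0≤f = +-nonneg (0≤f zero) (sumF-nonneg (λ i → f (suc i)) (λ i → 0≤f (suc i)))

  sumF-nonneg-≡0 : ∀ {n} (f : Fin n → Carrier) → (∀ i → 0# ≤ f i) → sumF F f ≡ 0# → ∀ i → f i ≡ 0#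
  sumF-nonneg-≡0 {ℕ.suc n} f 0≤f Σf≡0 zero =
    x+y≡0⇒x≡0 (0≤f zero) (sumF-nonneg _ (λ i → 0≤f (suc i))) Σf≡0
  sumF-nonneg-≡0 {ℕ.suc n} f 0≤f Σf≡0 (suc i) =
    sumF-nonneg-≡0 (λ i → f (suc i)) (λ i → 0≤f (suc i))
      (x+y≡0⇒x≡0 (sumF-nonneg _ (λ i → 0≤f (suc i))) (0≤f zero) (trans (+-comm _ _) Σf≡0)) i

  sumF-zero : ∀ {n} (f : Fin n → Carrier) → (∀ i → f i ≡ 0#) → sumF F f ≡ 0#
  sumF-zero {ℕ.zero}  f f≡0 = refl
  sumF-zero {ℕ.suc n} f f≡0 =
    trans (cong₂ _+_ (f≡0 zero) (sumF-zero _ (λ i → f≡0 (suc i)))) (+-identityˡ 0#)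

  sumF-cong : ∀ {n} {f g : Fin n → Carrier} → (∀ i → f i ≡ g i) → sumF F f ≡ sumF F g
  sumF-cong {ℕ.zero}  f≡g = refl
  sumF-cong {ℕ.suc n} f≡g = cong₂ _+_ (f≡g zero) (sumF-cong (λ i → f≡g (suc i)))

  indicator : Bool → Carrier
  indicator b = if b then 1# else 0#

  0≤indicator : ∀ b → 0# ≤ indicator b
  0≤indicator true  = 0≤1
  0≤indicator false = ≤-refl

  indicator-∧ : ∀ a b → indicator a * indicator b ≡ indicator (a ∧ b)
  indicator-∧ true  b = *-identityˡ (indicator b)
  indicator-∧ false b = zeroˡ (indicator b)

  sumF-indicator : ∀ {n} (f : Fin n → Bool) → sumF F (λ i → indicator (f i)) ≡ fromℕ (count f)
  sumF-indicator {ℕ.zero}  f = refl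
  sumF-indicator {ℕ.suc n} f with f zero
  ... | true  = cong (_+_ 1#) (sumF-indicator (λ i → f (suc i)))
  ... | false = trans (+-identityˡ _) (sumF-indicator (λ i → f (suc i)))

count-false : ∀ {n} (f : Fin n → Bool) → (∀ i → f i ≡ false) → count f ≡ 0
count-false {ℕ.zero}  f f≡false = refl
count-false {ℕ.suc n} f f≡false rewrite f≡false zero = count-false (λ i → f (suc i)) (λ i → f≡false (suc i))

count≡0⇒false : ∀ {n} (f : Fin n → Bool) → count f ≡ 0 → ∀ i → f i ≡ false
count≡0⇒false f count≡0 zero with f zero
... | false = refl
count≡0⇒false f count≡0 (suc i) with f zero
... | false = count≡0⇒false (λ i → f (suc i)) count≡0 i

Independent⇔nbrsIn≡0 : ∀ {n} (G : SimpleGraph n) (D : VSet n) →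
  Independent G D ⇔ (∀ v → D v ≡ true → nbrsIn G D v ≡ 0)
Independent⇔nbrsIn≡0 G D = mk⇔
  (λ indep v v∈D → count-false _ (λ u → no-edge-into-D v u (indep v u v∈D)))
  (λ nbrs≡0 u v u∈D v∈D →
    trans (sym (∧-identityʳ _)) (subst (λ b → adj G u v ∧ b ≡ false) v∈D (count≡0⇒false _ (nbrs≡0 u u∈D) v)))
  where
  no-edge-into-D : ∀ v u → (D u ≡ true → adj G v u ≡ false) → adj G v u ∧ D u ≡ false
  no-edge-into-D v u edge-free with D u
  ... | true  = trans (∧-identityʳ _) (edge-free refl)
  ... | false = ∧-zeroʳ _

isOne : ℤ → Bool
isOne (+ 1) = true
isOne _     = false

isCharVec-isOne : ∀ {n} (x : Fin n → ℤ) → (∀ v → x v ≡ ℤ.0ℤ ⊎ x v ≡ ℤ.1ℤ) → IsCharVec x (λ v → isOne (x v))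
isCharVec-isOne x binary v with binary v
... | inj₁ x≡0 rewrite x≡0 = refl
... | inj₂ x≡1 rewrite x≡1 = refl

module LCPOfGraph (F : OrderedField) {n : ℕ} (G : SimpleGraph n) (δ : OrderedField.Carrier F)
                  (0<δ : OrderedField._<_ F (OrderedField.0# F) δ) where
  open OrderedField F
  open OrderedFieldProperties F
  open IsTotalOrder isTotalOrder using () renaming (refl to ≤-refl)
  open CommutativeRing commutativeRing using (+-assoc; +-identityˡ; +-identityʳ; zeroˡ; zeroʳ)
  open Equivalence

  slack : (Fin n → Carrier) → Fin n → Carrier
  slack = lcpSlack F G δ

  neighbourSum : (Fin n → Carrier) → Fin n → Carrier
  neighbourSum X v = sumF F (λ u → adjMat F G v u * X u)

  δ≢0 : δ ≢ 0#
  δ≢0 δ≡0 = proj₂ 0<δ (sym δ≡0)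

  dominated⇔0≤δm-1 : ∀ m → (ceil (inv δ) ℤ.≤ + m) ⇔ (0# ≤ (δ * fromℕ m) - 1#)
  dominated⇔0≤δm-1 m = ⇔.trans (ceil≤+⇔≤fromℕ (inv δ) m) (⇔.sym (0≤xa-1⇔inv≤a 0<δ (fromℕ m)))

  0≤δ*neighbourSum : ∀ {X} → (∀ u → 0# ≤ X u) → ∀ v → 0# ≤ δ * neighbourSum X v
  0≤δ*neighbourSum 0≤X v =
    *-nonneg (proj₁ 0<δ) (sumF-nonneg _ (λ u → *-nonneg (0≤indicator (adj G v u)) (0≤X u)))

  complementary-slackness : ∀ {X} → IsLCPSolution F G δ X → ∀ v → X v ≢ 0# → slack X v ≡ 0#
  complementary-slackness (0≤X , 0≤slack , Σxw≡0) v Xv≢0 =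
    x*y≡0⇒y≡0 (sumF-nonneg-≡0 _ (λ u → *-nonneg (0≤X u) (0≤slack u)) Σxw≡0 v) Xv≢0

  module _ {X : Fin n → Carrier} (D : VSet n) (X≡χ : ∀ u → X u ≡ indicator (D u)) where

    neighbourSum-indicator : ∀ v → neighbourSum X v ≡ fromℕ (nbrsIn G D v)
    neighbourSum-indicator v = trans
      (sumF-cong (λ u → trans (cong (adjMat F G v u *_) (X≡χ u)) (indicator-∧ (adj G v u) (D u))))
      (sumF-indicator (λ u → adj G v u ∧ D u))

    slack-∈ : ∀ {v} → D v ≡ true → slack X v ≡ δ * fromℕ (nbrsIn G D v)
    slack-∈ {v} v∈D = begin
      (X v + δ * neighbourSum X v) - 1#  ≡⟨ cong (λ t → (t + δ * neighbourSum X v) - 1#) (trans (X≡χ v) (cong indicator v∈D)) ⟩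
      (1# + δ * neighbourSum X v) - 1#   ≡⟨ 1+x-1≡x _ ⟩
      δ * neighbourSum X v               ≡⟨ cong (δ *_) (neighbourSum-indicator v) ⟩
      δ * fromℕ (nbrsIn G D v)           ∎
      where open ≡-Reasoning

    slack-∉ : ∀ {v} → D v ≡ false → slack X v ≡ (δ * fromℕ (nbrsIn G D v)) - 1#
    slack-∉ {v} v∉D = begin
      (X v + δ * neighbourSum X v) - 1#  ≡⟨ cong (λ t → (t + δ * neighbourSum X v) - 1#) (trans (X≡χ v) (cong indicator v∉D)) ⟩
      (0# + δ * neighbourSum X v) - 1#   ≡⟨ cong (_- 1#) (+-identityˡ _) ⟩
      (δ * neighbourSum X v) - 1#        ≡⟨ cong (λ t → (δ * t) - 1#) (neighbourSum-indicator v) ⟩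
      (δ * fromℕ (nbrsIn G D v)) - 1#    ∎
      where open ≡-Reasoning

    kDominatingIndependent⇒solution : KDominating (ceil (inv δ)) G D → Independent G D → IsLCPSolution F G δ X
    kDominatingIndependent⇒solution dominating independent = 0≤X , 0≤slack , sumF-zero _ complementary
      where
      slack≡0 : ∀ {v} → D v ≡ true → slack X v ≡ 0#
      slack≡0 {v} v∈D = trans (slack-∈ v∈D)
        (trans (cong (λ m → δ * fromℕ m) (to (Independent⇔nbrsIn≡0 G D) independent v v∈D)) (zeroʳ δ))
      0≤X : ∀ v → 0# ≤ X v
      0≤X v = subst (0# ≤_) (sym (X≡χ v)) (0≤indicator (D v))
      0≤slack : ∀ v → 0# ≤ slack X v
      0≤slack v with D v in Dv≡
      ... | true  = subst (0# ≤_) (sym (slack≡0 Dv≡)) ≤-refl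
      ... | false = subst (0# ≤_) (sym (slack-∉ Dv≡)) (to (dominated⇔0≤δm-1 _) (dominating v Dv≡))
      complementary : ∀ v → X v * slack X v ≡ 0#
      complementary v with D v in Dv≡
      ... | true  = trans (cong (X v *_) (slack≡0 Dv≡)) (zeroʳ (X v))
      ... | false = trans (cong (_* slack X v) (trans (X≡χ v) (cong indicator Dv≡))) (zeroˡ _)

  charVec⇒indicator : ∀ {x : Fin n → ℤ} {D} → IsCharVec x D → ∀ v → fromℤ (x v) ≡ indicator (D v)
  charVec⇒indicator {x} {D} x≡χ v rewrite x≡χ v with D v
  ... | true  = +-identityʳ 1#
  ... | false = refl

  integral-solution-binary : (x : Fin n → ℤ) → IsLCPSolution F G δ (λ v → fromℤ (x v)) →
                             ∀ v → x v ≡ ℤ.0ℤ ⊎ x v ≡ ℤ.1ℤ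
  integral-solution-binary x sol@(0≤X , _ , _) v with x v in xv≡
  ... | + 0 = inj₁ refl
  ... | + 1 = inj₂ refl
  ... | -[1+ m ] = ⊥-elim (0≰-fromℕ-suc m (subst (0# ≤_) (cong fromℤ xv≡) (0≤X v)))
  ... | + ℕ.suc (ℕ.suc m) = ⊥-elim (fromℕ-suc≢0 m
          (x+y≡0⇒x≡0 (0≤fromℕ (ℕ.suc m)) (0≤δ*neighbourSum 0≤X v) 1+m+δN≡0))
    where
    N = δ * neighbourSum (λ u → fromℤ (x u)) v
    1+m+δN≡0 : fromℕ (ℕ.suc m) + N ≡ 0#
    1+m+δN≡0 = begin
      fromℕ (ℕ.suc m) + N                     ≡⟨ 1+x-1≡x _ ⟨
      (1# + (fromℕ (ℕ.suc m) + N)) - 1#       ≡⟨ cong (_- 1#) (+-assoc 1# _ N) ⟨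
      (fromℕ (ℕ.suc (ℕ.suc m)) + N) - 1#      ≡⟨ cong (λ t → (fromℤ t + N) - 1#) xv≡ ⟨
      slack (λ u → fromℤ (x u)) v             ≡⟨ complementary-slackness sol v (subst (λ t → fromℤ t ≢ 0#) (sym xv≡) (fromℕ-suc≢0 (ℕ.suc m))) ⟩
      0#                                      ∎
      where open ≡-Reasoning

  solution⇒kDominatingIndependent : (x : Fin n → ℤ) → IsLCPSolution F G δ (λ v → fromℤ (x v)) →
    Σ (VSet n) (λ D → IsCharVec x D × KDominating (ceil (inv δ)) G D × Independent G D)
  solution⇒kDominatingIndependent x sol@(_ , 0≤slack , _) = D , x≡χ , dominating , independent
    where
    D : VSet n
    D v = isOne (x v)
    x≡χ : IsCharVec x D
    x≡χ = isCharVec-isOne x (integral-solution-binary x sol)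
    X≡χ : ∀ v → fromℤ (x v) ≡ indicator (D v)
    X≡χ = charVec⇒indicator x≡χ
    dominating : KDominating (ceil (inv δ)) G D
    dominating v v∉D = from (dominated⇔0≤δm-1 _) (subst (0# ≤_) (slack-∉ D X≡χ v∉D) (0≤slack v))
    independent : Independent G D
    independent = from (Independent⇔nbrsIn≡0 G D) λ v v∈D → fromℕ≡0⇒≡0 (x*y≡0⇒y≡0
      (trans (sym (slack-∈ D X≡χ v∈D))
        (complementary-slackness sol v (λ Xv≡0 → 1≢0 (trans (sym (trans (X≡χ v) (cong indicator v∈D))) Xv≡0))))
      δ≢0)

open OrderedField using (Carrier; 0#; _<_; fromℤ; ceil; inv)

lemma3p2 : (F : OrderedField) (n : ℕ) (G : SimpleGraph n) (δ : Carrier F) → _<_ F (0# F) δ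
    → (x : Fin n → ℤ)
    → IsLCPSolution F G δ (λ v → fromℤ F (x v))
      ⇔ Σ (VSet n) (λ D → IsCharVec x D × KDominating (ceil F (inv F δ)) G D × Independent G D)
lemma3p2 F n G δ 0<δ x = mk⇔
  (solution⇒kDominatingIndependent x)
  (λ (D , x≡χ , dominating , independent) →
    kDominatingIndependent⇒solution D (charVec⇒indicator x≡χ) dominating independent)
  where open LCPOfGraph F G δ 0<δ
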